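{- Let $G$ be a simple graph, fix a vertex $P\in V(G)$, and let $D$ be a $P$-reduced divisor on $G$ with $r(D)=0$. Then there exists a vertex $Q\in V(G)$ with $Q\neq P$ such that $|D-Q|=\emptyset$ (i.e. $\operatorname{Proof}(D)\setminus\{P\}\neq\emptyset$).
   Context: A graph is a finite connected multigraph with no loop edges; a simple graph is a graph with no multiple edges and more than one vertex. A divisor on $G$ is a formal integer combination $D=\sum_{Q\in V(G)}D(Q)\,Q$; $\deg D=\sum_Q D(Q)$; effective means all coefficients $\ge0$. For $f:V(G)\to\mathbb{Z}$, $\Delta f$ is the divisor with $\Delta f(Q)=\sum_{e=QR\in E(G)}(f(Q)-f(R))$. $|D|=\{E\ge 0:E-D=\Delta f\text{ for some }f\}$. The rank $r(D)$ is $-1$ if $|D|=\emptyset$, and otherwise the largest $k\ge 0$ such that $|D-E|\neq\emptyset$ for every effective divisor $E$ of degree $k$. $\operatorname{Proof}(D)$ is the set of effective divisors $E$ of degree $r(D)+1$ with $|D-E|=\emptyset$. For $A\subseteq V(G)$ and $Q\in A$, $\operatorname{outdeg}_A(Q)$ is the number of edges joining $Q$ to a vertex outside $A$. $D$ is $P$-reduced if $D(Q)\ge 0$ for all $Q\neq P$, and every nonempty $A\subseteq V(G)\setminus\{P\}$ contains $Q$ with $\operatorname{outdeg}_A(Q)>D(Q)$. -}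

module Defs where

open import Data.Nat as ℕ using (ℕ; zero; suc)
open import Data.Integer as ℤ using (ℤ; +_; -[1+_])
open import Data.Fin using (Fin)
import Data.Fin as F
open import Data.Bool using (Bool; true; false; if_then_else_)
open import Data.Product using (Σ; ∃; _×_; _,_)
open import Relation.Binary.PropositionalEquality using (_≡_; _≢_)
open import Relation.Nullary using (¬_)
open import Data.Empty using (⊥)

Σℤ : ∀ {n} → (Fin n → ℤ) → ℤ
Σℤ {zero}  f = + 0
Σℤ {suc n} f = f F.zero ℤ.+ Σℤ {n} (λ i → f (F.suc i))

data Reachable {n : ℕ} (m : Fin n → Fin n → ℕ) : Fin n → Fin n → Set where
  here  : ∀ {Q} → Reachable m Q Q
  step  : ∀ {Q R S} → 0 ℕ.< m Q R → Reachable m R S → Reachable m Q S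

record Graph (n : ℕ) : Set where
  field
    mult      : Fin n → Fin n → ℕ
    symmetric : ∀ Q R → mult Q R ≡ mult R Q
    loopless  : ∀ Q → mult Q Q ≡ 0
    connected : ∀ Q R → Reachable mult Q R
open Graph public

IsSimple : ∀ {n} → Graph n → Set
IsSimple {n} G = (1 ℕ.< n) × (∀ Q R → mult G Q R ℕ.≤ 1)

Divisor : ℕ → Set
Divisor n = Fin n → ℤ

deg : ∀ {n} → Divisor n → ℤ
deg D = Σℤ D

Effective : ∀ {n} → Divisor n → Set
Effective D = ∀ Q → + 0 ℤ.≤ D Q

_-ᴰ_ : ∀ {n} → Divisor n → Divisor n → Divisor n
(D -ᴰ E) Q = D Q ℤ.- E Q

vertexDiv : ∀ {n} → Fin n → Divisor n
vertexDiv Q R with Q F.≟ R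
... | Relation.Nullary.yes _ = + 1
... | Relation.Nullary.no _  = + 0

Δ : ∀ {n} → Graph n → (Fin n → ℤ) → Divisor n
Δ G f Q = Σℤ (λ R → + (mult G Q R) ℤ.* (f Q ℤ.- f R))

InLinSys : ∀ {n} → Graph n → Divisor n → Divisor n → Set
InLinSys {n} G D E = Effective E × (∃ λ (f : Fin n → ℤ) → ∀ Q → (E -ᴰ D) Q ≡ Δ G f Q)

LinSysNonempty : ∀ {n} → Graph n → Divisor n → Set
LinSysNonempty G D = ∃ λ E → InLinSys G D E

GoodDegree : ∀ {n} → Graph n → Divisor n → ℕ → Set
GoodDegree G D k = ∀ E → Effective E → deg E ≡ + k → LinSysNonempty G (D -ᴰ E)

RankEq : ∀ {n} → Graph n → Divisor n → ℤ → Set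
RankEq G D -[1+ zero ]    = ¬ LinSysNonempty G D
RankEq G D -[1+ suc _ ]   = ⊥
RankEq G D (+ k) = LinSysNonempty G D × GoodDegree G D k
                   × (∀ k' → k ℕ.< k' → ¬ GoodDegree G D k')

outdeg : ∀ {n} → Graph n → (Fin n → Bool) → Fin n → ℤ
outdeg G A Q = Σℤ (λ R → if A R then + 0 else + (mult G Q R))

IsReduced : ∀ {n} → Graph n → Fin n → Divisor n → Set
IsReduced {n} G P D =
  (∀ Q → Q ≢ P → + 0 ℤ.≤ D Q) ×
  (∀ (A : Fin n → Bool) → A P ≡ false → (∃ λ Q → A Q ≡ true) →
     ∃ λ Q → A Q ≡ true × D Q ℤ.< outdeg G A Q)

-- If D(P) ≤ 0, reducedness applied to V ∖ {P} yields a neighbour Q of P with D(Q) = 0; a firing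
-- script f witnessing |D - Q| ≠ ∅ is minimal at P (D is P-reduced), is forced to be constant on the
-- neighbours of P because (Δf)(P) ≥ 0, hence (Δf)(Q) ≤ 0 and D - Q + Δf is negative at Q.
-- If D(P) ≥ 1, D is effective and D - P is effective. Normalising f(P) = 0, the scripts witnessing
-- |D - Q| ≠ ∅ are bounded in terms of deg D and the number of vertices, so |D - Q| ≠ ∅ is decidable
-- by a finite search; since r(D) = 0 rules out |D - Q| ≠ ∅ for every Q, the search finds Q ≠ P.
module Submission where

open import Defs
open import Data.Nat as ℕ using (ℕ; zero; suc)
import Data.Nat.Properties as ℕP
open import Data.Integer as ℤ using (ℤ; +_; -[1+_]; _+_; _-_; _*_; -_; _≤_; _<_; +≤+; +<+; -<+)
open import Data.Integer.Properties
open import Data.Integer.Tactic.RingSolver using (solve-∀)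
open import Data.Fin as F using (Fin)
import Data.Fin.Properties as FP
open import Data.Vec.Functional using (_∷_)
open import Data.Bool using (if_then_else_; not)
open import Data.Product using (∃; ∃₂; _×_; _,_; proj₁; proj₂)
open import Data.Sum using (inj₁; inj₂)
open import Data.Empty using (⊥-elim)
open import Function using (_∘_)
open import Relation.Binary.PropositionalEquality
open import Relation.Nullary using (¬_; yes; no; Dec; does)
open import Relation.Nullary.Decidable using (dec-true; dec-false; ¬?; _×-dec_; map′; decidable-stable)

Σℤ-cong : ∀ {n} {f g : Fin n → ℤ} → (∀ i → f i ≡ g i) → Σℤ f ≡ Σℤ g
Σℤ-cong {zero}  f≡g = refl
Σℤ-cong {suc n} f≡g = cong₂ _+_ (f≡g F.zero) (Σℤ-cong (f≡g ∘ F.suc))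

Σℤ-mono-≤ : ∀ {n} {f g : Fin n → ℤ} → (∀ i → f i ≤ g i) → Σℤ f ≤ Σℤ g
Σℤ-mono-≤ {zero}  f≤g = ≤-refl
Σℤ-mono-≤ {suc n} f≤g = +-mono-≤ (f≤g F.zero) (Σℤ-mono-≤ (f≤g ∘ F.suc))

Σℤ-const : ∀ n (c : ℤ) → Σℤ {n} (λ _ → c) ≡ + n * c
Σℤ-const zero    c = sym (*-zeroˡ c)
Σℤ-const (suc n) c = trans (cong (λ x → c + x) (Σℤ-const n c)) (sym (suc-* (+ n) c))

Σℤ-zero : ∀ n → Σℤ {n} (λ _ → + 0) ≡ + 0
Σℤ-zero n = trans (Σℤ-const n (+ 0)) (*-zeroʳ (+ n))

Σℤ-nonNeg : ∀ {n} {f : Fin n → ℤ} → (∀ i → + 0 ≤ f i) → + 0 ≤ Σℤ f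
Σℤ-nonNeg {n} 0≤f = ≤-trans (≤-reflexive (sym (Σℤ-zero n))) (Σℤ-mono-≤ 0≤f)

Σℤ-distrib-- : ∀ {n} (f g : Fin n → ℤ) → Σℤ (λ i → f i - g i) ≡ Σℤ f - Σℤ g
Σℤ-distrib-- {zero}  f g = refl
Σℤ-distrib-- {suc n} f g =
  trans (cong (λ x → f F.zero - g F.zero + x) (Σℤ-distrib-- (f ∘ F.suc) (g ∘ F.suc)))
        (interchange (f F.zero) (g F.zero) _ _)
  where
  interchange : ∀ a b c d → a - b + (c - d) ≡ a + c - (b + d)
  interchange = solve-∀

Σℤ-neg : ∀ {n} (f : Fin n → ℤ) → Σℤ (λ i → - f i) ≡ - Σℤ f
Σℤ-neg {zero}  f = refl
Σℤ-neg {suc n} f =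
  trans (cong (λ x → - f F.zero + x) (Σℤ-neg (f ∘ F.suc))) (sym (neg-distrib-+ (f F.zero) _))

≤-Σℤ : ∀ {n} {f : Fin n → ℤ} → (∀ i → + 0 ≤ f i) → ∀ j → f j ≤ Σℤ f
≤-Σℤ {suc n} {f} 0≤f F.zero    = i≤i+j (f F.zero) _ {{ℤ.nonNegative (Σℤ-nonNeg (0≤f ∘ F.suc))}}
≤-Σℤ {suc n} {f} 0≤f (F.suc j) =
  i≤j⇒i≤k+j (f F.zero) {{ℤ.nonNegative (0≤f F.zero)}} (≤-Σℤ (0≤f ∘ F.suc) j)

Σℤ-≤ : ∀ {n} {f : Fin n → ℤ} → (∀ i → f i ≤ + 0) → ∀ j → Σℤ f ≤ f j
Σℤ-≤ {f = f} f≤0 j =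
  neg-cancel-≤ (≤-trans (≤-Σℤ (neg-mono-≤ ∘ f≤0) j) (≤-reflexive (Σℤ-neg f)))

Σℤ-supported : ∀ {n} {f : Fin n → ℤ} j → (∀ i → i ≢ j → f i ≡ + 0) → Σℤ f ≡ f j
Σℤ-supported {suc n} {f} F.zero f≡0 =
  trans (cong (λ x → f F.zero + x) (trans (Σℤ-cong (λ i → f≡0 (F.suc i) λ ())) (Σℤ-zero n)))
        (+-identityʳ (f F.zero))
Σℤ-supported {suc n} {f} (F.suc j) f≡0 =
  trans (cong (_+ Σℤ (f ∘ F.suc)) (f≡0 F.zero λ ()))
        (trans (+-identityˡ _) (Σℤ-supported j (λ i i≢j → f≡0 (F.suc i) (i≢j ∘ FP.suc-injective))))

m*[i-j]≤0 : ∀ m {i j} → i ≤ j → + m * (i - j) ≤ + 0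
m*[i-j]≤0 m i≤j = ≤-trans (*-monoˡ-≤-nonNeg (+ m) (i≤j⇒i-j≤0 i≤j)) (≤-reflexive (*-zeroʳ (+ m)))

m*[i-j]≤-m : ∀ m {i j} → i < j → + m * (i - j) ≤ - + m
m*[i-j]≤-m m {i} {j} i<j = begin
  + m * (i - j)                        ≡⟨ cong (+ m *_) (shift i j) ⟩
  + m * (-[1+ 0 ] + (+ 1 + i - j))     ≤⟨ *-monoˡ-≤-nonNeg (+ m) (+-monoʳ-≤ -[1+ 0 ] 1+i-j≤0) ⟩
  + m * -[1+ 0 ]                       ≡⟨ times-minus-one (+ m) ⟩
  - + m                                ∎
  where
  open ≤-Reasoning
  1+i-j≤0 : + 1 + i - j ≤ + 0
  1+i-j≤0 = i≤j⇒i-j≤0 (i<j⇒suc[i]≤j i<j)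
  shift : ∀ i j → i - j ≡ -[1+ 0 ] + (+ 1 + i - j)
  shift = solve-∀
  times-minus-one : ∀ a → a * -[1+ 0 ] ≡ - a
  times-minus-one = solve-∀

vertexDiv-self : ∀ {n} (u : Fin n) → vertexDiv u u ≡ + 1
vertexDiv-self u with u F.≟ u
... | yes _   = refl
... | no u≢u = ⊥-elim (u≢u refl)

vertexDiv-other : ∀ {n} {u Q : Fin n} → u ≢ Q → vertexDiv u Q ≡ + 0
vertexDiv-other {u = u} {Q} u≢Q with u F.≟ Q
... | yes u≡Q = ⊥-elim (u≢Q u≡Q)
... | no _    = refl

vertexDiv-nonNeg : ∀ {n} (u Q : Fin n) → + 0 ≤ vertexDiv u Q
vertexDiv-nonNeg u Q with u F.≟ Q
... | yes _ = +≤+ ℕ.z≤n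
... | no _  = +≤+ ℕ.z≤n

deg-vertexDiv : ∀ {n} (u : Fin n) → deg (vertexDiv u) ≡ + 1
deg-vertexDiv u = trans (Σℤ-supported u (λ Q Q≢u → vertexDiv-other (Q≢u ∘ sym))) (vertexDiv-self u)

-ᴰ-vertexDiv-≤ : ∀ {n} (D : Divisor n) (u Q : Fin n) → (D -ᴰ vertexDiv u) Q ≤ D Q
-ᴰ-vertexDiv-≤ D u Q = i-j≤i (D Q) (vertexDiv u Q) {{ℤ.nonNegative (vertexDiv-nonNeg u Q)}}

effective-ᴰ-vertexDiv : ∀ {n} {D : Divisor n} {u : Fin n} →
  Effective D → + 0 < D u → Effective (D -ᴰ vertexDiv u)
effective-ᴰ-vertexDiv {D = D} {u} effD 0<Du Q with u F.≟ Q
... | yes refl = i≤j⇒0≤j-i (i<j⇒suc[i]≤j 0<Du)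
... | no _     = ≤-trans (effD Q) (≤-reflexive (sym (+-identityʳ (D Q))))

effective-deg-one : ∀ {n} {E : Divisor n} → Effective E → deg E ≡ + 1 →
  ∃ λ u → ∀ Q → E Q ≡ vertexDiv u Q
effective-deg-one {n} {E} effE degE≡1 with FP.any? (λ u → + 0 ℤ.<? E u)
... | no none = ⊥-elim (<⇒≱ (+<+ (ℕ.s≤s ℕ.z≤n))
                  (≤-trans (≤-reflexive (sym degE≡1))
                    (≤-trans (Σℤ-mono-≤ λ u → ≮⇒≥ (λ 0<Eu → none (u , 0<Eu))) (≤-reflexive (Σℤ-zero n)))))
... | yes (u , 0<Eu) = u , λ Q → i-j≡0⇒i≡j (E Q) (vertexDiv u Q) (rest≡0 Q)
  where
  rest : Divisor n
  rest = E -ᴰ vertexDiv u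
  deg-rest : deg rest ≡ + 0
  deg-rest = trans (Σℤ-distrib-- E (vertexDiv u)) (cong₂ _-_ degE≡1 (deg-vertexDiv u))
  rest≡0 : ∀ Q → rest Q ≡ + 0
  rest≡0 Q = ≤-antisym (≤-trans (≤-Σℤ (effective-ᴰ-vertexDiv effE 0<Eu) Q) (≤-reflexive deg-rest))
                       (effective-ᴰ-vertexDiv effE 0<Eu Q)

module _ {n} (G : Graph n) where

  Δ-cong : ∀ {f g : Fin n → ℤ} → (∀ i → f i ≡ g i) → ∀ Q → Δ G f Q ≡ Δ G g Q
  Δ-cong f≡g Q = Σℤ-cong λ R → cong (+ mult G Q R *_) (cong₂ _-_ (f≡g Q) (f≡g R))

  Δ-shift : ∀ (f : Fin n → ℤ) c Q → Δ G (λ i → f i - c) Q ≡ Δ G f Q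
  Δ-shift f c Q = Σℤ-cong λ R → cong (+ mult G Q R *_) (cancel (f Q) (f R) c)
    where
    cancel : ∀ a b c → a - c - (b - c) ≡ a - b
    cancel = solve-∀

  Δ-const : ∀ c Q → Δ G (λ _ → c) Q ≡ + 0
  Δ-const c Q =
    trans (Σℤ-cong λ R → trans (cong (+ mult G Q R *_) (+-inverseʳ c)) (*-zeroʳ (+ mult G Q R)))
          (Σℤ-zero n)

  Δ-nonPos-at-minimum : ∀ {f : Fin n → ℤ} {Q} → (∀ R → f Q ≤ f R) → Δ G f Q ≤ + 0
  Δ-nonPos-at-minimum {Q = Q} min =
    ≤-trans (Σℤ-mono-≤ λ R → m*[i-j]≤0 (mult G Q R) (min R)) (≤-reflexive (Σℤ-zero n))

  -- A vertex where the minimum c is attained loses a chip along each edge to a vertex above c.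
  Δ-at-minimum : ∀ {f : Fin n → ℤ} {u} c → (∀ R → c ≤ f R) → f u ≡ c →
    Δ G f u ≤ - outdeg G (λ R → does (f R ℤ.≟ c)) u
  Δ-at-minimum {f} {u} c c≤f fu≡c =
    ≤-trans (Σℤ-mono-≤ edge) (≤-reflexive (Σℤ-neg (λ R → if does (f R ℤ.≟ c) then + 0 else + mult G u R)))
    where
    edge : ∀ R → + mult G u R * (f u - f R) ≤ - (if does (f R ℤ.≟ c) then + 0 else + mult G u R)
    edge R with f R ℤ.≟ c
    ... | yes fR≡c = ≤-reflexive (trans (cong (+ mult G u R *_) (trans (cong₂ _-_ fu≡c fR≡c) (+-inverseʳ c)))
                                        (*-zeroʳ (+ mult G u R)))
    ... | no fR≢c  = m*[i-j]≤-m (mult G u R) (≤-<-trans (≤-reflexive fu≡c) (≤∧≢⇒< (c≤f R) (fR≢c ∘ sym)))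

  Δ-at-minimum-flat : ∀ {f : Fin n → ℤ} {P Q} → (∀ R → f P ≤ f R) → + 0 ≤ Δ G f P →
    0 ℕ.< mult G P Q → f Q ≡ f P
  Δ-at-minimum-flat {f} {P} {Q} min 0≤ΔP 0<m with i*j≡0⇒i≡0∨j≡0 (+ mult G P Q) term≡0
    where
    term : Fin n → ℤ
    term R = + mult G P R * (f P - f R)
    term≤0 : ∀ R → term R ≤ + 0
    term≤0 R = m*[i-j]≤0 (mult G P R) (min R)
    term≡0 : term Q ≡ + 0
    term≡0 = ≤-antisym (term≤0 Q) (≤-trans 0≤ΔP (Σℤ-≤ term≤0 Q))
  ... | inj₁ m≡0      = ⊥-elim (ℕP.<-irrefl (sym (+-injective m≡0)) 0<m)
  ... | inj₂ fP-fQ≡0 = sym (i-j≡0⇒i≡j (f P) (f Q) fP-fQ≡0)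

EffectiveAfter : ∀ {n} → Graph n → Divisor n → (Fin n → ℤ) → Set
EffectiveAfter G D f = Effective (λ Q → D Q + Δ G f Q)

module _ {n} (G : Graph n) {D : Divisor n} where

  linSys⇒effectiveAfter : LinSysNonempty G D → ∃ (EffectiveAfter G D)
  linSys⇒effectiveAfter (E , effE , f , E-D≡Δf) =
    f , λ Q → subst (+ 0 ≤_) (trans (sym (restore (E Q) (D Q))) (cong (λ x → D Q + x) (E-D≡Δf Q))) (effE Q)
    where
    restore : ∀ e d → d + (e - d) ≡ e
    restore = solve-∀

  effectiveAfter⇒linSys : ∀ f → EffectiveAfter G D f → LinSysNonempty G D
  effectiveAfter⇒linSys f eff = (λ Q → D Q + Δ G f Q) , eff , f , λ Q → cancel (D Q) (Δ G f Q)
    where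
    cancel : ∀ a b → a + b - a ≡ b
    cancel = solve-∀

  effectiveAfter-resp-Δ : ∀ f g → (∀ Q → Δ G f Q ≡ Δ G g Q) →
    EffectiveAfter G D f → EffectiveAfter G D g
  effectiveAfter-resp-Δ f g Δf≡Δg eff Q = subst (λ x → + 0 ≤ D Q + x) (Δf≡Δg Q) (eff Q)

  effective⇒linSys : Effective D → LinSysNonempty G D
  effective⇒linSys effD = effectiveAfter⇒linSys (λ _ → + 0) λ Q →
    subst (+ 0 ≤_) (sym (trans (cong (λ x → D Q + x) (Δ-const G (+ 0) Q)) (+-identityʳ (D Q)))) (effD Q)

effectiveAfter-mono : ∀ {n} (G : Graph n) {D D' : Divisor n} f → (∀ Q → D Q ≤ D' Q) →
  EffectiveAfter G D f → EffectiveAfter G D' f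
effectiveAfter-mono G f D≤D' eff Q = ≤-trans (eff Q) (+-monoˡ-≤ (Δ G f Q) (D≤D' Q))

linSys-cong : ∀ {n} (G : Graph n) {D D' : Divisor n} → (∀ Q → D Q ≡ D' Q) →
  LinSysNonempty G D → LinSysNonempty G D'
linSys-cong G D≡D' (E , effE , f , E-D≡Δf) = E , effE , f , λ Q → trans (cong (λ x → E Q - x) (sym (D≡D' Q))) (E-D≡Δf Q)

goodDegree-one : ∀ {n} (G : Graph n) (D : Divisor n) →
  (∀ u → LinSysNonempty G (D -ᴰ vertexDiv u)) → GoodDegree G D 1
goodDegree-one G D lifts E effE degE≡1 with effective-deg-one effE degE≡1
... | u , E≡u = linSys-cong G (λ Q → cong (λ x → D Q - x) (sym (E≡u Q))) (lifts u)

minimum : ∀ {n} (f : Fin (suc n) → ℤ) → ∃ λ i → ∀ j → f i ≤ f j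
minimum {zero}  f = F.zero , λ { F.zero → ≤-refl }
minimum {suc n} f with minimum (f ∘ F.suc)
... | i , min with f F.zero ℤ.≤? f (F.suc i)
... | yes f0≤fi = F.zero  , λ { F.zero → ≤-refl ; (F.suc j) → ≤-trans f0≤fi (min j) }
... | no f0≰fi  = F.suc i , λ { F.zero → <⇒≤ (≰⇒> f0≰fi) ; (F.suc j) → min j }

-- If f P were not minimal, the set where f is minimal would avoid P, and reducedness would give
-- a vertex of it at which D + Δf is negative.
reduced-minimum : ∀ {n} (G : Graph n) {P : Fin n} {D : Divisor n} →
  IsReduced G P D → ∀ f → EffectiveAfter G D f → ∀ Q → f P ≤ f Q
reduced-minimum {suc n} G {P} {D} (_ , burn) f eff Q with minimum f
... | i , min with f P ℤ.≟ f i
... | yes fP≡fi = ≤-trans (≤-reflexive fP≡fi) (min Q)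
... | no fP≢fi  = ⊥-elim (<⇒≱ (+-mono-<-≤ Du<out (Δ-at-minimum G (f i) min fu≡fi))
                                (≤-trans (≤-reflexive (+-inverseʳ (outdeg G A u))) (eff u)))
  where
  A = λ R → does (f R ℤ.≟ f i)
  found = burn A (dec-false (f P ℤ.≟ f i) fP≢fi) (i , dec-true (f i ℤ.≟ f i) refl)
  u = proj₁ found
  Du<out : D u < outdeg G A u
  Du<out = proj₂ (proj₂ found)
  fu≡fi : f u ≡ f i
  fu≡fi with f u ℤ.≟ f i | proj₁ (proj₂ found)
  ... | yes fu≡fi | _ = fu≡fi
  ... | no _      | ()

reduced-neighbour : ∀ {n} (G : Graph n) → IsSimple G → {P : Fin n} {D : Divisor n} →
  IsReduced G P D → ∃ λ Q → Q ≢ P × 0 ℕ.< mult G Q P × D Q ≡ + 0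
reduced-neighbour G (ℕ.s≤s (ℕ.s≤s ℕ.z≤n) , simple) {P} {D} (D≥0 , burn) =
  Q , Q≢P , drop‿+<+ (≤-<-trans (≤-reflexive (sym DQ≡0)) DQ<m) , DQ≡0
  where
  A = λ R → not (does (R F.≟ P))
  found = burn A (cong not (dec-true (P F.≟ P) refl))
               (F.punchIn P F.zero , cong not (dec-false (_ F.≟ P) (FP.punchInᵢ≢i P F.zero)))
  Q = proj₁ found
  Q≢P : Q ≢ P
  Q≢P with Q F.≟ P | proj₁ (proj₂ found)
  ... | no Q≢P | _ = Q≢P
  outdeg≡m : outdeg G A Q ≡ + mult G Q P
  outdeg≡m = trans (Σℤ-supported P λ R R≢P → cong (λ b → if not b then + 0 else + mult G Q R)
                                                    (dec-false (R F.≟ P) R≢P))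
                   (cong (λ b → if not b then + 0 else + mult G Q P) (dec-true (P F.≟ P) refl))
  DQ<m : D Q < + mult G Q P
  DQ<m = <-≤-trans (proj₂ (proj₂ found)) (≤-reflexive outdeg≡m)
  DQ≡0 : D Q ≡ + 0
  DQ≡0 = ≤-antisym (<⇒≤pred (<-≤-trans DQ<m (+≤+ (simple Q P)))) (D≥0 Q Q≢P)
    where
    <⇒≤pred : ∀ {x} → x < + 1 → x ≤ + 0
    <⇒≤pred x<1 = ≮⇒≥ λ 0<x → <⇒≱ x<1 (i<j⇒suc[i]≤j 0<x)

nonPositive-at-root : ∀ {n} (G : Graph n) → IsSimple G → (P : Fin n) (D : Divisor n) →
  IsReduced G P D → D P ≤ + 0 → ∃ λ Q → Q ≢ P × ¬ LinSysNonempty G (D -ᴰ vertexDiv Q)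
nonPositive-at-root G simple P D red DP≤0 with reduced-neighbour G simple red
... | Q , Q≢P , 0<mQP , DQ≡0 = Q , Q≢P , λ lin → no-script (linSys⇒effectiveAfter G lin)
  where
  no-script : ¬ ∃ (EffectiveAfter G (D -ᴰ vertexDiv Q))
  no-script (f , eff) = <⇒≱ -<+ (≤-trans (eff Q) at-Q)
    where
    min : ∀ R → f P ≤ f R
    min = reduced-minimum G red f (effectiveAfter-mono G f (-ᴰ-vertexDiv-≤ D Q) eff)
    0≤ΔP : + 0 ≤ Δ G f P
    0≤ΔP = begin
      + 0                                  ≤⟨ eff P ⟩
      D P - vertexDiv Q P + Δ G f P        ≡⟨ cong (λ v → D P - v + Δ G f P) (vertexDiv-other Q≢P) ⟩
      D P - + 0 + Δ G f P                  ≤⟨ +-monoˡ-≤ (Δ G f P) (≤-trans (≤-reflexive (+-identityʳ (D P))) DP≤0) ⟩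
      + 0 + Δ G f P                        ≡⟨ +-identityˡ (Δ G f P) ⟩
      Δ G f P                              ∎
      where open ≤-Reasoning
    fQ≡fP : f Q ≡ f P
    fQ≡fP = Δ-at-minimum-flat G min 0≤ΔP (subst (0 ℕ.<_) (symmetric G Q P) 0<mQP)
    at-Q : D Q - vertexDiv Q Q + Δ G f Q ≤ -[1+ 0 ]
    at-Q = +-mono-≤ (≤-reflexive (cong₂ _-_ DQ≡0 (vertexDiv-self Q)))
                    (Δ-nonPos-at-minimum G λ R → ≤-trans (≤-reflexive fQ≡fP) (min R))

crossing-edge : ∀ {n} {m : Fin n → Fin n → ℕ} (f : Fin n → ℤ) (c : ℤ) {a b : Fin n} →
  Reachable m a b → f a ≤ c → c < f b → ∃₂ λ x y → 0 ℕ.< m x y × f x ≤ c × c < f y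
crossing-edge f c here fa≤c c<fb = ⊥-elim (<⇒≱ c<fb fa≤c)
crossing-edge f c (step {Q} {R} 0<m path) fQ≤c c<fb with f R ℤ.≤? c
... | yes fR≤c = crossing-edge f c path fR≤c c<fb
... | no fR≰c  = Q , R , 0<m , fQ≤c , ≰⇒> fR≰c

neighbour-bound : ∀ {n} (G : Graph n) → (∀ Q R → mult G Q R ℕ.≤ 1) → {D : Divisor n} (d : ℕ) →
  (∀ w → D w ≤ + d) → (f : Fin n → ℤ) → (∀ w → + 0 ≤ f w) → EffectiveAfter G D f →
  ∀ w u → 0 ℕ.< mult G w u → f u ≤ + d + + n * f w
neighbour-bound {n} G simple {D} d D≤d f f≥0 eff w u 0<m = begin
  f u                                           ≡⟨ sym (*-identityˡ (f u)) ⟩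
  + 1 * f u                                     ≤⟨ *-monoʳ-≤-nonNeg (f u) {{ℤ.nonNegative (f≥0 u)}} (+≤+ 0<m) ⟩
  m u * f u                                     ≤⟨ ≤-Σℤ (λ R → ≤-trans (≤-reflexive (sym (*-zeroʳ (m R)))) (*-monoˡ-≤-nonNeg (m R) (f≥0 R))) u ⟩
  Σℤ (λ R → m R * f R)                          ≡⟨ Σℤ-cong (λ R → split (m R) (f w) (f R)) ⟩
  Σℤ (λ R → m R * f w - m R * (f w - f R))      ≡⟨ Σℤ-distrib-- (λ R → m R * f w) (λ R → m R * (f w - f R)) ⟩
  Σℤ (λ R → m R * f w) - Δ G f w                ≤⟨ +-mono-≤ degree-bound (≤-trans fired (D≤d w)) ⟩
  + n * f w + + d                               ≡⟨ +-comm (+ n * f w) (+ d) ⟩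
  + d + + n * f w                               ∎
  where
  open ≤-Reasoning
  m : Fin n → ℤ
  m R = + mult G w R
  split : ∀ a x y → a * y ≡ a * x - a * (x - y)
  split = solve-∀
  degree-bound : Σℤ (λ R → m R * f w) ≤ + n * f w
  degree-bound = ≤-trans (Σℤ-mono-≤ λ R → ≤-trans (*-monoʳ-≤-nonNeg (f w) {{ℤ.nonNegative (f≥0 w)}} (+≤+ (simple w R)))
                                                   (≤-reflexive (*-identityˡ (f w))))
                         (≤-reflexive (Σℤ-const n (f w)))
  fired : - Δ G f w ≤ D w
  fired = 0≤i-j⇒j≤i (≤-trans (eff w) (≤-reflexive (minus-neg (D w) (Δ G f w))))
    where
    minus-neg : ∀ a b → a + b ≡ a - - b
    minus-neg = solve-∀

level : ℕ → ℕ → ℕ → ℕ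
level d n zero    = 0
level d n (suc k) = d ℕ.+ n ℕ.* level d n k

level-mono : ∀ d n {i j} → i ℕ.≤ j → level d n i ℕ.≤ level d n j
level-mono d n {zero}          _            = ℕ.z≤n
level-mono d n {suc i} {suc j} (ℕ.s≤s i≤j) = ℕP.+-monoʳ-≤ d (ℕP.*-monoʳ-≤ n (level-mono d n i≤j))

-- If some f u exceeded level n, a path from P to u would cross every level k ≤ n along an edge,
-- entering a vertex x_k with level (k - 1) < f x_k ≤ level k; these n + 1 vertices are distinct.
script-bound : ∀ {n} (G : Graph n) (P : Fin n) (d : ℕ) (f : Fin n → ℤ) → f P ≡ + 0 →
  (∀ w u → 0 ℕ.< mult G w u → f u ≤ + d + + n * f w) → ∀ u → f u ≤ + level d n n
script-bound {n} G P d f fP≡0 step-bound u with f u ℤ.≤? + level d n n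
... | yes bounded   = bounded
... | no unbounded = ⊥-elim (<⇒≱ (<-≤-trans (proj₁ (in-level j)) (≤-reflexive (cong f (sym xi≡xj))))
                                  (≤-trans (proj₂ (in-level i)) (level-below (F.toℕ i) (F.toℕ j) i<j)))
  where
  below : ℕ → ℤ
  below zero    = -[1+ 0 ]
  below (suc k) = + level d n k
  level-below : ∀ a b → a ℕ.< b → + level d n a ≤ below b
  level-below a (suc b) (ℕ.s≤s a≤b) = +≤+ (level-mono d n a≤b)
  vertex-at : ∀ k → k ℕ.≤ n → ∃ λ x → below k < f x × f x ≤ + level d n k
  vertex-at zero    _   = P , subst (-[1+ 0 ] <_) (sym fP≡0) -<+ , ≤-reflexive fP≡0
  vertex-at (suc k) k<n
    with crossing-edge f (+ level d n k) (connected G P u) (≤-trans (≤-reflexive fP≡0) (+≤+ ℕ.z≤n))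
                       (≤-<-trans (+≤+ (level-mono d n (ℕP.<⇒≤ k<n))) (≰⇒> unbounded))
  ... | x , y , 0<m , fx≤ , <fy =
    y , <fy , ≤-trans (step-bound x y 0<m)
                (≤-trans (+-monoʳ-≤ (+ d) (*-monoˡ-≤-nonNeg (+ n) fx≤))
                         (≤-reflexive (sym (trans (pos-+ d _) (cong (λ x → + d + x) (pos-* n _))))))
  x : Fin (suc n) → Fin n
  x k = proj₁ (vertex-at (F.toℕ k) (FP.toℕ≤pred[n] k))
  in-level : ∀ k → below (F.toℕ k) < f (x k) × f (x k) ≤ + level d n (F.toℕ k)
  in-level k = proj₂ (vertex-at (F.toℕ k) (FP.toℕ≤pred[n] k))
  collision = FP.pigeonhole (ℕP.n<1+n n) x
  i = proj₁ collision
  j = proj₁ (proj₂ collision)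
  i<j = proj₁ (proj₂ (proj₂ collision))
  xi≡xj = proj₂ (proj₂ (proj₂ collision))

any?-functions : ∀ {n m} {Pr : (Fin n → Fin m) → Set} →
  (∀ {g h} → (∀ i → g i ≡ h i) → Pr g → Pr h) → (∀ g → Dec (Pr g)) → Dec (∃ Pr)
any?-functions {zero} {m} resp Pr? = map′ (empty ,_) (λ (g , p) → resp {g} (λ ()) p) (Pr? empty)
  where
  empty : Fin zero → Fin m
  empty ()
any?-functions {suc n} resp Pr? =
  map′ (λ (x , g , p) → x ∷ g , p)
       (λ (g , p) → g F.zero , g ∘ F.suc , resp (λ { F.zero → refl ; (F.suc i) → refl }) p)
       (FP.any? λ x → any?-functions (λ g≗h → resp λ { F.zero → refl ; (F.suc i) → g≗h i }) (Pr? ∘ (x ∷_)))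

bounded-as-Fin : ∀ {n} B (f : Fin n → ℤ) → (∀ i → + 0 ≤ f i) → (∀ i → f i ≤ + B) →
  ∃ λ (g : Fin n → Fin (suc B)) → ∀ i → + F.toℕ (g i) ≡ f i
bounded-as-Fin B f f≥0 f≤B = (λ i → F.fromℕ< (abs< i)) , λ i →
  trans (cong +_ (FP.toℕ-fromℕ< (abs< i))) (0≤i⇒+∣i∣≡i (f≥0 i))
  where
  abs< : ∀ i → ℤ.∣ f i ∣ ℕ.< suc B
  abs< i = ℕ.s≤s (drop‿+≤+ (≤-trans (≤-reflexive (0≤i⇒+∣i∣≡i (f≥0 i))) (f≤B i)))

-- Every script for D' ≤ D is minimal at P (reduced-minimum), so once normalised to f(P) = 0 it
-- takes values in [0, level d n n] and a finite search suffices.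
linSys-dec : ∀ {n} (G : Graph n) → (∀ Q R → mult G Q R ℕ.≤ 1) → (P : Fin n) (D : Divisor n) →
  IsReduced G P D → Effective D → (D' : Divisor n) → (∀ Q → D' Q ≤ D Q) → Dec (LinSysNonempty G D')
linSys-dec {n} G simple P D red effD D' D'≤D =
  map′ (λ (g , eff) → effectiveAfter⇒linSys G (script g) eff) bounded-script
       (any?-functions (λ {g} {h} g≗h → effectiveAfter-resp-Δ G {D'} (script g) (script h) (Δ-cong G λ i → cong (+_ ∘ F.toℕ) (g≗h i)))
                       (λ g → FP.all? λ Q → + 0 ℤ.≤? D' Q + Δ G (script g) Q))
  where
  d = ℤ.∣ deg D ∣
  D≤d : ∀ w → D w ≤ + d
  D≤d w = ≤-trans (≤-Σℤ effD w) (≤-reflexive (sym (0≤i⇒+∣i∣≡i (Σℤ-nonNeg effD))))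
  script : (Fin n → Fin (suc (level d n n))) → Fin n → ℤ
  script g i = + F.toℕ (g i)
  bounded-script : LinSysNonempty G D' → ∃ λ g → EffectiveAfter G D' (script g)
  bounded-script lin with linSys⇒effectiveAfter G lin
  ... | f , eff = g , effectiveAfter-resp-Δ G {D'} f₀ (script g) (Δ-cong G (sym ∘ g≡f₀)) eff₀
    where
    f₀ : Fin n → ℤ
    f₀ i = f i - f P
    eff₀ : EffectiveAfter G D' f₀
    eff₀ = effectiveAfter-resp-Δ G {D'} f f₀ (sym ∘ Δ-shift G f (f P)) eff
    f₀≥0 : ∀ i → + 0 ≤ f₀ i
    f₀≥0 i = i≤j⇒0≤j-i (reduced-minimum G red f (effectiveAfter-mono G f D'≤D eff) i)
    f₀≤B : ∀ i → f₀ i ≤ + level d n n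
    f₀≤B = script-bound G P d f₀ (+-inverseʳ (f P))
             (neighbour-bound G simple d D≤d f₀ f₀≥0 (effectiveAfter-mono G f₀ D'≤D eff₀))
    g = proj₁ (bounded-as-Fin (level d n n) f₀ f₀≥0 f₀≤B)
    g≡f₀ = proj₂ (bounded-as-Fin (level d n n) f₀ f₀≥0 f₀≤B)

lemma3p2 : ∀ {n : ℕ} (G : Graph n) → IsSimple G → (P : Fin n) (D : Divisor n) →
    IsReduced G P D → RankEq G D (+ 0) →
    ∃ λ (Q : Fin n) → Q ≢ P × ¬ LinSysNonempty G (D -ᴰ vertexDiv Q)
lemma3p2 G simple P D red (_ , _ , rank≤0) with D P ℤ.≤? + 0
... | yes DP≤0 = nonPositive-at-root G simple P D red DP≤0
... | no DP≰0  = decide (FP.any? λ Q → ¬? (Q F.≟ P) ×-dec ¬? (lin? Q))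
  where
  effD : Effective D
  effD Q with Q F.≟ P
  ... | yes refl = <⇒≤ (≰⇒> DP≰0)
  ... | no Q≢P   = proj₁ red Q Q≢P
  lin? : ∀ Q → Dec (LinSysNonempty G (D -ᴰ vertexDiv Q))
  lin? Q = linSys-dec G (proj₂ simple) P D red effD (D -ᴰ vertexDiv Q) (-ᴰ-vertexDiv-≤ D Q)
  decide : Dec (∃ λ Q → Q ≢ P × ¬ LinSysNonempty G (D -ᴰ vertexDiv Q)) →
           ∃ λ Q → Q ≢ P × ¬ LinSysNonempty G (D -ᴰ vertexDiv Q)
  decide (yes found) = found
  decide (no none)   = ⊥-elim (rank≤0 1 (ℕ.s≤s ℕ.z≤n) (goodDegree-one G D lifts))
    where
    lifts : ∀ Q → LinSysNonempty G (D -ᴰ vertexDiv Q)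
    lifts Q with Q F.≟ P
    ... | yes refl = effective⇒linSys G (effective-ᴰ-vertexDiv effD (≰⇒> DP≰0))
    ... | no Q≢P   = decidable-stable (lin? Q) (λ ¬lin → none (Q , Q≢P , ¬lin))
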